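{- Given an ultraword $X$ of length $\ell$, the prefix sum of $X$ can be computed in $O(\log \ell)$ time on a restricted UWRAM and in $O(1)$ time on a multiplication UWRAM.
   Context: An ultraword consists of $w^2$ bits, viewed as $w$ words of $w$ bits each, numbered right-to-left from $0$; $X\langle j\rangle$ denotes the $j$th word of $X$. The leftmost bit of each word is reserved as a test bit. $X$ has length $\ell \le w$ if only its rightmost $\ell$ words are non-zero. The prefix sum of $X$ of length $\ell$ is the ultraword $P$ of length $\ell$ with $P\langle j\rangle = \sum_{k\le j} X\langle k\rangle$; it is assumed these sums never exceed the capacity of a word. The restricted UWRAM supports constant-time addition, subtraction, shifts, and bitwise boolean operations on ultrawords (as well as standard word RAM operations); the multiplication UWRAM additionally supports constant-time multiplication of ultrawords. Time is the number of instructions. -}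

module Defs where

open import Data.Nat using (ℕ; zero; suc; _+_; _*_; _∸_; _^_; _≤_; _<_; _≡ᵇ_; _<ᵇ_)
open import Data.Nat.DivMod using (_/_; _%_)
open import Data.Nat.Logarithm using (⌈log₂_⌉)
open import Data.Bool using (Bool; true; false; if_then_else_)
open import Data.List using (List; lookup; length)
open import Data.List.Relation.Unary.All using (All)
open import Data.Fin using (Fin)
open import Data.Maybe using (Maybe; just; nothing)
open import Data.Product using (Σ; _×_; _,_; ∃)
open import Relation.Binary.PropositionalEquality using (_≡_)
open import Data.Unit using (⊤)
open import Data.Empty using (⊥)
open import Data.Nat.Properties using (_<?_; m^n≢0)
open import Data.Nat using (NonZero)
open import Relation.Nullary using (yes; no)

mod2^ : ℕ → ℕ → ℕ
mod2^ a n = _%_ a (2 ^ n) {{m^n≢0 2 n}}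

div2^ : ℕ → ℕ → ℕ
div2^ a n = _/_ a (2 ^ n) {{m^n≢0 2 n}}

-- natural-number division, with division by zero returning 0
divW : ℕ → ℕ → ℕ
divW a zero    = 0
divW a (suc b) = a / suc b

bitwise : (ℕ → ℕ → ℕ) → ℕ → ℕ → ℕ → ℕ
bitwise f zero    a b = 0
bitwise f (suc n) a b = f (a % 2) (b % 2) + 2 * bitwise f n (a / 2) (b / 2)

andBit orBit xorBit : ℕ → ℕ → ℕ
andBit 1 1 = 1
andBit _ _ = 0
orBit 0 0 = 0
orBit _ _ = 1
xorBit 0 1 = 1
xorBit 1 0 = 1
xorBit _ _ = 0

addMod subMod mulMod : ℕ → ℕ → ℕ → ℕ
addMod B a b = mod2^ (a + b) B
subMod B a b = mod2^ (mod2^ a B + (2 ^ B ∸ mod2^ b B)) B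
mulMod B a b = mod2^ (a * b) B

shlMod shrB : ℕ → ℕ → ℕ → ℕ
shlMod B a s = mod2^ (a * 2 ^ s) B
shrB   B a s = div2^ (mod2^ a B) s

notB : ℕ → ℕ → ℕ
notB B a = bitwise xorBit B a (2 ^ B ∸ 1)

data BinOp : Set where
  add sub mul and or xor shl shr : BinOp

evalOp : ℕ → BinOp → ℕ → ℕ → ℕ
evalOp B add a b = addMod B a b
evalOp B sub a b = subMod B a b
evalOp B mul a b = mulMod B a b
evalOp B and a b = bitwise andBit B a b
evalOp B or  a b = bitwise orBit  B a b
evalOp B xor a b = bitwise xorBit B a b
evalOp B shl a b = shlMod B a b
evalOp B shr a b = shrB   B a b

-- registers are indexed by ℕ; word registers hold w-bit words,
-- ultraword registers hold w²-bit ultrawords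
data Instr : Set where
  wconst : (d k : ℕ) → Instr
  wop    : BinOp → (d a b : ℕ) → Instr
  wdiv   : (d a b : ℕ) → Instr
  wnot   : (d a : ℕ) → Instr
  uconst : (d k : ℕ) → Instr
  uop    : BinOp → (d a b : ℕ) → Instr
  ushl   : (d a s : ℕ) → Instr                -- U[d] := U[a] << W[s]
  ushr   : (d a s : ℕ) → Instr                -- U[d] := U[a] >> W[s]
  unot   : (d a : ℕ) → Instr
  wtou   : (d s : ℕ) → Instr                  -- U[d] := W[s]  (as word 0)
  utow   : (d s : ℕ) → Instr                  -- W[d] := U[s]⟨0⟩
  jz     : (r tgt : ℕ) → Instr
  halt   : Instr

Program : Set
Program = List Instr

data Model : Set where
  restricted multiplication : Model

Allowed : Model → Instr → Set
Allowed restricted (uop mul d a b) = ⊥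
Allowed restricted (uop shl d a b) = ⊥   -- ultraword shifts use ushl/ushr
Allowed restricted (uop shr d a b) = ⊥
Allowed multiplication (uop shl d a b) = ⊥
Allowed multiplication (uop shr d a b) = ⊥
Allowed _ _ = ⊤

record State : Set where
  constructor st
  field
    pc : ℕ
    W  : ℕ → ℕ
    U  : ℕ → ℕ
open State public

upd : (ℕ → ℕ) → ℕ → ℕ → (ℕ → ℕ)
upd f d v i = if i ≡ᵇ d then v else f i

fetch : Program → ℕ → Maybe Instr
fetch p i with i <? length p
... | yes i<n = just (lookup p (Data.Fin.fromℕ< i<n))
... | no _    = nothing

exec : (w : ℕ) → Instr → State → State
exec w (wconst d k)   (st pc W U) = st (suc pc) (upd W d (mod2^ k w)) U
exec w (wop o d a b)  (st pc W U) = st (suc pc) (upd W d (evalOp w o (W a) (W b))) U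
exec w (wdiv d a b)   (st pc W U) = st (suc pc) (upd W d (divW (W a) (W b))) U
exec w (wnot d a)     (st pc W U) = st (suc pc) (upd W d (notB w (W a))) U
exec w (uconst d k)   (st pc W U) = st (suc pc) W (upd U d (mod2^ k (w * w)))
exec w (uop o d a b)  (st pc W U) = st (suc pc) W (upd U d (evalOp (w * w) o (U a) (U b)))
exec w (ushl d a s)   (st pc W U) = st (suc pc) W (upd U d (shlMod (w * w) (U a) (W s)))
exec w (ushr d a s)   (st pc W U) = st (suc pc) W (upd U d (shrB (w * w) (U a) (W s)))
exec w (unot d a)     (st pc W U) = st (suc pc) W (upd U d (notB (w * w) (U a)))
exec w (wtou d s)     (st pc W U) = st (suc pc) W (upd U d (mod2^ (W s) w))
exec w (utow d s)     (st pc W U) = st (suc pc) (upd W d (mod2^ (U s) w)) U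
exec w (jz r tgt)     (st pc W U) = st (if W r ≡ᵇ 0 then tgt else suc pc) W U
exec w halt           s           = s

-- one step; a halted machine (at a halt instruction or outside the program) stays put
step : (w : ℕ) → Program → State → State
step w p s with fetch p (pc s)
... | just i  = exec w i s
... | nothing = s

run : (w : ℕ) → Program → ℕ → State → State
run w p zero    s = s
run w p (suc t) s = run w p t (step w p s)

Halted : Program → State → Set
Halted p s = fetch p (pc s) ≡ just halt

-- j-th word of ultraword X (w-bit words, numbered from the right)
word : (w X j : ℕ) → ℕ
word w X j = mod2^ (div2^ X (j * w)) w

HasLength : (w ℓ X : ℕ) → Set
HasLength w ℓ X = X < 2 ^ (w * w) × ℓ ≤ w × (∀ j → ℓ ≤ j → j < w → word w X j ≡ 0)

prefix : (w X j : ℕ) → ℕ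
prefix w X zero    = word w X 0
prefix w X (suc j) = prefix w X j + word w X (suc j)

IsPrefixSum : (w ℓ X P : ℕ) → Set
IsPrefixSum w ℓ X P = HasLength w ℓ P × (∀ j → j < ℓ → word w P j ≡ prefix w X j)

-- the prefix sums fit in a word without touching the test bit
SumsFit : (w ℓ X : ℕ) → Set
SumsFit w ℓ X = ∀ j → j < ℓ → prefix w X j < 2 ^ (w ∸ 1)

initState : (w ℓ X : ℕ) → State
initState w ℓ X = st 0 (upd (upd (λ _ → 0) 0 w) 1 ℓ) (upd (λ _ → 0) 0 X)

ComputesPrefixSumIn : (w : ℕ) → Program → (ℕ → ℕ) → Set
ComputesPrefixSumIn w p T =
  ∀ ℓ X → HasLength w ℓ X → SumsFit w ℓ X →
  Σ ℕ λ t → t ≤ T ℓ ×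
    Halted p (run w p t (initState w ℓ X)) ×
    IsPrefixSum w ℓ X (U (run w p t (initState w ℓ X)) 0)

-- The prefix sum is computable in time O(f ℓ) in model M: there is a constant c
-- such that for every word size w there is a program (using only M's
-- instructions; it may depend on w, e.g. through w-dependent constants)
-- running within c * f ℓ steps.
PrefixSumIn : Model → (ℕ → ℕ) → Set
PrefixSumIn M f =
  Σ ℕ λ c → ∀ w → Σ Program λ p → All (Allowed M) p × ComputesPrefixSumIn w p (λ ℓ → c * f ℓ)

module Submission where

open import Defs
open import Data.Nat using (suc)
open import Data.Nat.Logarithm using (⌈log₂_⌉)
open import Data.Product using (_×_)

open import Data.Nat
  using (ℕ; zero; _+_; _*_; _∸_; _^_; _≤_; _<_; z≤n; s≤s; NonZero; _≡ᵇ_; ⌊_/2⌋)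
open import Data.Nat.Properties
open import Data.Nat.DivMod
open import Data.Nat.Divisibility using (n∣m*n)
open import Data.Nat.Logarithm using (⌈log₂2^n⌉≡n; ⌈log₂⌉-mono-≤; ⌈log₂⌈n/2⌉⌉≡⌈log₂n⌉∸1)
open import Data.Nat.Solver using (module +-*-Solver)
open import Data.Product using (Σ; _,_; proj₁; proj₂)
open import Data.Sum using (inj₁; inj₂)
open import Data.Empty using (⊥-elim)
open import Data.Unit using (tt)
open import Data.Bool using (if_then_else_)
open import Data.List using ([]; _∷_)
open import Data.List.Relation.Unary.All using (All; []; _∷_)
open import Data.List.Relation.Unary.All.Properties using (++⁺)
open import Relation.Nullary using (yes; no)
open import Function using (_∘_)
open import Relation.Binary.PropositionalEquality

open +-*-Solver using (solve; _:+_; _:*_; _:=_; con)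

-- An ultraword is the base-2^w numeral whose digits are its words.  Multiplying X by
-- the ultraword whose every word is 1 adds each word into all the words above it, so
-- the product holds the prefix sums (the capacity assumption rules out carries).
-- Without multiplication one doubles windows instead: if word j holds the sum of the
-- d words ending at j, adding the ultraword shifted up by d words makes it hold the
-- sum of the 2d words ending at j, and after ⌈log₂ ℓ⌉ rounds every window reaches
-- word 0.  Finally the words from position ℓ on are cleared by shifting the ultraword
-- up by w − ℓ words and back down.

module _ {n : ℕ} .{{_ : NonZero n}} where

  [m+kn]%n≡m : ∀ m k → m < n → (m + k * n) % n ≡ m
  [m+kn]%n≡m m k m<n = trans ([m+kn]%n≡m%n m k n) (m<n⇒m%n≡m m<n)

  [m+kn]/n≡k : ∀ m k → m < n → (m + k * n) / n ≡ k
  [m+kn]/n≡k m k m<n =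
    trans (+-distrib-/-∣ʳ m (n∣m*n k)) (cong₂ _+_ (m<n⇒m/n≡0 m<n) (m*n/n≡m k n))

[m*n]%o≡[m%o*n]%o : ∀ m n o .{{_ : NonZero o}} → (m * n) % o ≡ ((m % o) * n) % o
[m*n]%o≡[m%o*n]%o m n o = begin
  (m * n) % o                   ≡⟨ %-distribˡ-* m n o ⟩
  (m % o * (n % o)) % o         ≡⟨ cong (λ z → (z * (n % o)) % o) (sym (m%n%n≡m%n m o)) ⟩
  (m % o % o * (n % o)) % o     ≡⟨ sym (%-distribˡ-* (m % o) n o) ⟩
  ((m % o) * n) % o             ∎
  where open ≡-Reasoning

m%[n*o]≡m%n+n*[m/n%o] : ∀ m n o .{{_ : NonZero n}} .{{_ : NonZero o}} .{{_ : NonZero (n * o)}} →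
  m % (n * o) ≡ m % n + n * ((m / n) % o)
m%[n*o]≡m%n+n*[m/n%o] m n o = trans (cong (_% (n * o)) m≡r+q*no) ([m+kn]%n≡m r (m / n / o) r<no)
  where
  r = m % n + n * ((m / n) % o)
  m≡r+q*no : m ≡ r + m / n / o * (n * o)
  m≡r+q*no = begin
    m                                       ≡⟨ m≡m%n+[m/n]*n m n ⟩
    m % n + m / n * n                       ≡⟨ cong (λ z → m % n + z * n) (m≡m%n+[m/n]*n (m / n) o) ⟩
    m % n + (m / n % o + m / n / o * o) * n
      ≡⟨ solve 5 (λ a b c n o → a :+ (b :+ c :* o) :* n := a :+ n :* b :+ c :* (n :* o))
               refl (m % n) (m / n % o) (m / n / o) n o ⟩
    r + m / n / o * (n * o)                 ∎
    where open ≡-Reasoning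
  r<no : r < n * o
  r<no = begin-strict
    m % n + n * ((m / n) % o) <⟨ +-monoˡ-< (n * ((m / n) % o)) (m%n<n m n) ⟩
    n + n * ((m / n) % o)     ≡⟨ sym (*-suc n _) ⟩
    n * suc ((m / n) % o)     ≤⟨ *-monoʳ-≤ n (m%n<n (m / n) o) ⟩
    n * o                     ∎
    where open ≤-Reasoning

[m+n*o]%[n*p]≡[m+n*[o%p]]%[n*p] : ∀ m n o p .{{_ : NonZero p}} .{{_ : NonZero (n * p)}} →
  (m + n * o) % (n * p) ≡ (m + n * (o % p)) % (n * p)
[m+n*o]%[n*p]≡[m+n*[o%p]]%[n*p] m n o p = begin
  (m + n * o) % (n * p)
    ≡⟨ cong (λ z → (m + n * z) % (n * p)) (m≡m%n+[m/n]*n o p) ⟩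
  (m + n * (o % p + o / p * p)) % (n * p)
    ≡⟨ cong (_% (n * p)) (solve 5 (λ m n a b p → m :+ n :* (a :+ b :* p) := m :+ n :* a :+ b :* (n :* p))
                                refl m n (o % p) (o / p) p) ⟩
  (m + n * (o % p) + o / p * (n * p)) % (n * p)
    ≡⟨ [m+kn]%n≡m%n (m + n * (o % p)) (o / p) (n * p) ⟩
  (m + n * (o % p)) % (n * p) ∎
  where open ≡-Reasoning

m+m≡2*m : ∀ m → m + m ≡ 2 * m
m+m≡2*m m = cong (m +_) (sym (+-identityʳ m))

m∸1<n⇒m≤n : ∀ {m n} → m ∸ 1 < n → m ≤ n
m∸1<n⇒m≤n {zero}  _   = z≤n
m∸1<n⇒m≤n {suc m} m<n = m<n

2^n≢0 : ∀ n → NonZero (2 ^ n)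
2^n≢0 n = m^n≢0 2 n

2^n>0 : ∀ n → 0 < 2 ^ n
2^n>0 n = m^n>0 2 n

2^-mono : ∀ {m n} → m ≤ n → 2 ^ m ≤ 2 ^ n
2^-mono m≤n = ^-monoʳ-≤ 2 m≤n

n<2^n : ∀ n → n < 2 ^ n
n<2^n zero    = s≤s z≤n
n<2^n (suc n) = begin-strict
  suc n         ≤⟨ n<2^n n ⟩
  2 ^ n         <⟨ m<m+n (2 ^ n) (2^n>0 n) ⟩
  2 ^ n + 2 ^ n ≡⟨ m+m≡2*m (2 ^ n) ⟩
  2 ^ suc n     ∎
  where open ≤-Reasoning

[1+n]*n<2^[1+n] : ∀ n → suc n * n < 2 ^ suc n
[1+n]*n<2^[1+n] zero    = s≤s z≤n
[1+n]*n<2^[1+n] (suc n) = begin-strict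
  suc (suc n) * suc n
    ≡⟨ solve 1 (λ n → (con 2 :+ n) :* (con 1 :+ n) := (con 1 :+ n) :* n :+ con 2 :* (con 1 :+ n)) refl n ⟩
  suc n * n + 2 * suc n     <⟨ +-monoˡ-< (2 * suc n) ([1+n]*n<2^[1+n] n) ⟩
  2 ^ suc n + 2 * suc n     ≤⟨ +-monoʳ-≤ (2 ^ suc n) (*-monoʳ-≤ 2 (n<2^n n)) ⟩
  2 ^ suc n + 2 ^ suc n     ≡⟨ m+m≡2*m (2 ^ suc n) ⟩
  2 ^ suc (suc n)           ∎
  where open ≤-Reasoning

mod2^<2^ : ∀ m n → mod2^ m n < 2 ^ n
mod2^<2^ m n = m%n<n m (2 ^ n) {{2^n≢0 n}}

mod2^-small : ∀ m n → m < 2 ^ n → mod2^ m n ≡ m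
mod2^-small m n = m<n⇒m%n≡m {{2^n≢0 n}}

div2^-small : ∀ m n → m < 2 ^ n → div2^ m n ≡ 0
div2^-small m n = m<n⇒m/n≡0 {{2^n≢0 n}}

mod2^-low : ∀ n r q → r < 2 ^ n → mod2^ (r + q * 2 ^ n) n ≡ r
mod2^-low n = [m+kn]%n≡m {{2^n≢0 n}}

div2^-high : ∀ n r q → r < 2 ^ n → div2^ (r + q * 2 ^ n) n ≡ q
div2^-high n = [m+kn]/n≡k {{2^n≢0 n}}

div2^-+ : ∀ m a b → div2^ m (a + b) ≡ div2^ (div2^ m a) b
div2^-+ m a b = sym (trans
  (m/n/o≡m/[n*o] m (2 ^ a) (2 ^ b) {{2^n≢0 a}} {{2^n≢0 b}} {{2^a*2^b≢0}})
  (/-congʳ {{2^a*2^b≢0}} {{2^n≢0 (a + b)}} (sym (^-distribˡ-+-* 2 a b))))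
  where 2^a*2^b≢0 = m*n≢0 (2 ^ a) (2 ^ b) {{2^n≢0 a}} {{2^n≢0 b}}

mod2^-+ : ∀ m a b → mod2^ m (a + b) ≡ mod2^ m a + 2 ^ a * mod2^ (div2^ m a) b
mod2^-+ m a b = trans
  (%-congʳ {{2^n≢0 (a + b)}} {{2^a*2^b≢0}} (^-distribˡ-+-* 2 a b))
  (m%[n*o]≡m%n+n*[m/n%o] m (2 ^ a) (2 ^ b) {{2^n≢0 a}} {{2^n≢0 b}} {{2^a*2^b≢0}})
  where 2^a*2^b≢0 = m*n≢0 (2 ^ a) (2 ^ b) {{2^n≢0 a}} {{2^n≢0 b}}

div2^-1 : ∀ m → div2^ m 1 ≡ ⌊ m /2⌋
div2^-1 zero          = refl
div2^-1 (suc zero)    = refl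
div2^-1 (suc (suc m)) = trans (m/n≡1+[m∸n]/n {suc (suc m)} {2} (s≤s (s≤s z≤n))) (cong suc (div2^-1 m))

div2^-suc : ∀ m k → div2^ m (suc k) ≡ ⌊ div2^ m k /2⌋
div2^-suc m k = trans (cong (div2^ m) (+-comm 1 k)) (trans (div2^-+ m k 1) (div2^-1 (div2^ m k)))

addMod-double : ∀ B a → addMod B (mod2^ a B) (mod2^ a B) ≡ mod2^ (2 * a) B
addMod-double B a = trans (sym (%-distribˡ-+ a a (2 ^ B) {{2^n≢0 B}})) (cong (λ z → mod2^ z B) (m+m≡2*m a))

subMod≡∸ : ∀ B a b → b ≤ a → a < 2 ^ B → subMod B a b ≡ a ∸ b
subMod≡∸ B a b b≤a a<2^B = begin
  mod2^ (mod2^ a B + (2 ^ B ∸ mod2^ b B)) B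
    ≡⟨ cong₂ (λ p q → mod2^ (p + (2 ^ B ∸ q)) B) (mod2^-small a B a<2^B) (mod2^-small b B b<2^B) ⟩
  mod2^ (a + (2 ^ B ∸ b)) B                   ≡⟨ cong (λ z → mod2^ z B) a+[2^B∸b]≡[a∸b]+2^B ⟩
  mod2^ ((a ∸ b) + 1 * 2 ^ B) B               ≡⟨ mod2^-low B (a ∸ b) 1 (≤-<-trans (m∸n≤m a b) a<2^B) ⟩
  a ∸ b                                       ∎
  where
  open ≡-Reasoning
  b<2^B = ≤-<-trans b≤a a<2^B
  a+[2^B∸b]≡[a∸b]+2^B : a + (2 ^ B ∸ b) ≡ (a ∸ b) + 1 * 2 ^ B
  a+[2^B∸b]≡[a∸b]+2^B = begin
    a + (2 ^ B ∸ b)             ≡⟨ cong (_+ (2 ^ B ∸ b)) (sym (m∸n+n≡m b≤a)) ⟩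
    (a ∸ b) + b + (2 ^ B ∸ b)   ≡⟨ +-assoc (a ∸ b) b _ ⟩
    (a ∸ b) + (b + (2 ^ B ∸ b)) ≡⟨ cong ((a ∸ b) +_) (trans (m+[n∸m]≡n (<⇒≤ b<2^B)) (sym (+-identityʳ _))) ⟩
    (a ∸ b) + 1 * 2 ^ B         ∎

shlMod-+ : ∀ B a x y → shlMod B (shlMod B a x) y ≡ shlMod B a (x + y)
shlMod-+ B a x y = begin
  (a * 2 ^ x % m * 2 ^ y) % m ≡⟨ sym ([m*n]%o≡[m%o*n]%o (a * 2 ^ x) (2 ^ y) m) ⟩
  (a * 2 ^ x * 2 ^ y) % m     ≡⟨ cong (_% m) (trans (*-assoc a _ _) (cong (a *_) (sym (^-distribˡ-+-* 2 x y)))) ⟩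
  (a * 2 ^ (x + y)) % m       ∎
  where
  open ≡-Reasoning
  m = 2 ^ B
  instance _ = 2^n≢0 B

shrB-+ : ∀ B a x y → a < 2 ^ B → shrB B (shrB B a x) y ≡ div2^ a (x + y)
shrB-+ B a x y a<2^B = begin
  div2^ (mod2^ (div2^ (mod2^ a B) x) B) y ≡⟨ cong (λ z → div2^ (mod2^ (div2^ z x) B) y) (mod2^-small a B a<2^B) ⟩
  div2^ (mod2^ (div2^ a x) B) y           ≡⟨ cong (λ z → div2^ z y) (mod2^-small (div2^ a x) B a/2^x<2^B) ⟩
  div2^ (div2^ a x) y                     ≡⟨ sym (div2^-+ a x y) ⟩
  div2^ a (x + y)                         ∎
  where
  open ≡-Reasoning
  a/2^x<2^B = ≤-<-trans (m/n≤m a (2 ^ x) {{2^n≢0 x}}) a<2^B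

shrB-1 : ∀ B a → a < 2 ^ B → shrB B a 1 ≡ ⌊ a /2⌋
shrB-1 B a a<2^B = trans (cong (λ z → div2^ z 1) (mod2^-small a B a<2^B)) (div2^-1 a)

psum : (ℕ → ℕ) → ℕ → ℕ
psum x zero    = 0
psum x (suc j) = psum x j + x j

prefix≡psum : ∀ w X j → prefix w X j ≡ psum (word w X) (suc j)
prefix≡psum w X zero    = refl
prefix≡psum w X (suc j) = cong (_+ word w X (suc j)) (prefix≡psum w X j)

psum-mono : ∀ x {i j} → i ≤ j → psum x i ≤ psum x j
psum-mono x {j = zero}  z≤n = z≤n
psum-mono x {j = suc j} i≤1+j with m≤n⇒m<n∨m≡n i≤1+j
... | inj₁ (s≤s i≤j) = ≤-trans (psum-mono x i≤j) (m≤m+n (psum x j) (x j))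
... | inj₂ refl      = ≤-refl

psum-stable : ∀ x ℓ → (∀ k → ℓ ≤ k → x k ≡ 0) → ∀ j → ℓ ≤ j → psum x j ≡ psum x ℓ
psum-stable x ℓ vanish zero    z≤n  = refl
psum-stable x ℓ vanish (suc j) ℓ≤1+j with m≤n⇒m<n∨m≡n ℓ≤1+j
... | inj₁ (s≤s ℓ≤j) = trans (cong₂ _+_ (psum-stable x ℓ vanish j ℓ≤j) (vanish j ℓ≤j)) (+-identityʳ _)
... | inj₂ refl      = refl

-- The sum of the d words ending at position j (fewer if j < d).
window : ℕ → (ℕ → ℕ) → ℕ → ℕ
window d x j = psum x (suc j) ∸ psum x (suc j ∸ d)

window≤psum : ∀ d x j → window d x j ≤ psum x (suc j)
window≤psum d x j = m∸n≤m (psum x (suc j)) (psum x (suc j ∸ d))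

window-1 : ∀ x j → window 1 x j ≡ x j
window-1 x j = m+n∸m≡n (psum x j) (x j)

window-≥ : ∀ d x j → suc j ≤ d → window d x j ≡ psum x (suc j)
window-≥ d x j 1+j≤d rewrite m≤n⇒m∸n≡0 1+j≤d = refl

shiftUp : ℕ → (ℕ → ℕ) → ℕ → ℕ
shiftUp zero    f j       = f j
shiftUp (suc d) f zero    = 0
shiftUp (suc d) f (suc j) = shiftUp d f j

shiftUp-+ : ∀ d f j → shiftUp d f (d + j) ≡ f j
shiftUp-+ zero    f j = refl
shiftUp-+ (suc d) f j = shiftUp-+ d f j

shiftUp-< : ∀ d f j → j < d → shiftUp d f j ≡ 0
shiftUp-< (suc d) f zero    _         = refl
shiftUp-< (suc d) f (suc j) (s≤s j<d) = shiftUp-< d f j j<d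

[m∸n]+[n∸o]≡m∸o : ∀ m n o → o ≤ n → n ≤ m → (m ∸ n) + (n ∸ o) ≡ m ∸ o
[m∸n]+[n∸o]≡m∸o m n o o≤n n≤m = begin
  (m ∸ n) + (n ∸ o) ≡⟨ sym (+-∸-assoc (m ∸ n) o≤n) ⟩
  (m ∸ n + n) ∸ o   ≡⟨ cong (_∸ o) (m∸n+n≡m n≤m) ⟩
  m ∸ o             ∎
  where open ≡-Reasoning

window-double : ∀ d x j → window d x j + shiftUp d (window d x) j ≡ window (d + d) x j
window-double d x j with j <? d
... | yes j<d
  rewrite shiftUp-< d (window d x) j j<d | m≤n⇒m∸n≡0 j<d | m≤n⇒m∸n≡0 (≤-trans j<d (m≤m+n d d))
  = +-identityʳ _
... | no j≮d = begin
  window d x j + shiftUp d (window d x) j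
    ≡⟨ cong (λ z → window d x z + shiftUp d (window d x) z) (sym d+i≡j) ⟩
  window d x (d + i) + shiftUp d (window d x) (d + i)
    ≡⟨ cong (window d x (d + i) +_) (shiftUp-+ d (window d x) i) ⟩
  (psum x (suc (d + i)) ∸ psum x (suc (d + i) ∸ d)) + (psum x (suc i) ∸ psum x (suc i ∸ d))
    ≡⟨ cong (λ z → (psum x (suc (d + i)) ∸ psum x z) + (psum x (suc i) ∸ psum x (suc i ∸ d))) lower ⟩
  (psum x (suc (d + i)) ∸ psum x (suc i)) + (psum x (suc i) ∸ psum x (suc i ∸ d))
    ≡⟨ [m∸n]+[n∸o]≡m∸o _ _ _ (psum-mono x (m∸n≤m (suc i) d)) (psum-mono x (s≤s (m≤n+m i d))) ⟩
  psum x (suc (d + i)) ∸ psum x (suc i ∸ d)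
    ≡⟨ cong (λ z → psum x (suc (d + i)) ∸ psum x z) lowest ⟩
  window (d + d) x (d + i)
    ≡⟨ cong (window (d + d) x) d+i≡j ⟩
  window (d + d) x j ∎
  where
  open ≡-Reasoning
  i = j ∸ d
  d+i≡j : d + i ≡ j
  d+i≡j = m+[n∸m]≡n (≮⇒≥ j≮d)
  lower : suc (d + i) ∸ d ≡ suc i
  lower = trans (cong (_∸ d) (sym (+-suc d i))) (m+n∸m≡n d (suc i))
  lowest : suc i ∸ d ≡ suc (d + i) ∸ (d + d)
  lowest = sym (trans (cong (_∸ (d + d)) (sym (+-suc d i))) ([m+n]∸[m+o]≡n∸o d (suc i) d))

ones : ℕ → ℕ
ones _ = 1

module Packing (w : ℕ) where

  pack : (ℕ → ℕ) → ℕ → ℕ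
  pack f zero    = 0
  pack f (suc n) = f 0 + 2 ^ w * pack (f ∘ suc) n

  Fits : (ℕ → ℕ) → Set
  Fits f = ∀ j → f j < 2 ^ w

  pack-cong : ∀ n f g → (∀ j → j < n → f j ≡ g j) → pack f n ≡ pack g n
  pack-cong zero    f g f≗g = refl
  pack-cong (suc n) f g f≗g =
    cong₂ (λ a b → a + 2 ^ w * b) (f≗g 0 (s≤s z≤n)) (pack-cong n _ _ (λ j j<n → f≗g (suc j) (s≤s j<n)))

  pack-+ : ∀ n f g → pack (λ j → f j + g j) n ≡ pack f n + pack g n
  pack-+ zero    f g = refl
  pack-+ (suc n) f g rewrite pack-+ n (f ∘ suc) (g ∘ suc) =
    solve 5 (λ a b B p q → a :+ b :+ B :* (p :+ q) := a :+ B :* p :+ (b :+ B :* q))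
          refl (f 0) (g 0) (2 ^ w) (pack (f ∘ suc) n) (pack (g ∘ suc) n)

  pack<2^ : ∀ n f → Fits f → pack f n < 2 ^ (n * w)
  pack<2^ zero    f fits = s≤s z≤n
  pack<2^ (suc n) f fits = begin-strict
    f 0 + 2 ^ w * p     <⟨ +-monoˡ-< (2 ^ w * p) (fits 0) ⟩
    2 ^ w + 2 ^ w * p   ≡⟨ sym (*-suc (2 ^ w) p) ⟩
    2 ^ w * suc p       ≤⟨ *-monoʳ-≤ (2 ^ w) (pack<2^ n (f ∘ suc) (fits ∘ suc)) ⟩
    2 ^ w * 2 ^ (n * w) ≡⟨ sym (^-distribˡ-+-* 2 w (n * w)) ⟩
    2 ^ (w + n * w)     ∎
    where
    open ≤-Reasoning
    p = pack (f ∘ suc) n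

  pack-++ : ∀ a b f → pack f (a + b) ≡ pack f a + pack (λ j → f (a + j)) b * 2 ^ (a * w)
  pack-++ zero    b f = sym (*-identityʳ _)
  pack-++ (suc a) b f rewrite pack-++ a b (f ∘ suc) | ^-distribˡ-+-* 2 w (a * w) =
    solve 5 (λ x B p q C → x :+ B :* (p :+ q :* C) := x :+ B :* p :+ q :* (B :* C))
          refl (f 0) (2 ^ w) (pack (f ∘ suc) a) (pack (λ j → f (suc (a + j))) b) (2 ^ (a * w))

  shiftUp-fits : ∀ d f → Fits f → Fits (shiftUp d f)
  shiftUp-fits zero    f fits j       = fits j
  shiftUp-fits (suc d) f fits zero    = 2^n>0 w
  shiftUp-fits (suc d) f fits (suc j) = shiftUp-fits d f fits j

  pack-shiftUp : ∀ d n f → pack f n * 2 ^ (d * w) ≡ pack (shiftUp d f) (d + n)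
  pack-shiftUp zero    n f = *-identityʳ _
  pack-shiftUp (suc d) n f = begin
    pack f n * 2 ^ (w + d * w)       ≡⟨ cong (pack f n *_) (^-distribˡ-+-* 2 w (d * w)) ⟩
    pack f n * (2 ^ w * 2 ^ (d * w)) ≡⟨ solve 3 (λ p B C → p :* (B :* C) := B :* (p :* C)) refl (pack f n) (2 ^ w) _ ⟩
    2 ^ w * (pack f n * 2 ^ (d * w)) ≡⟨ cong (2 ^ w *_) (pack-shiftUp d n f) ⟩
    2 ^ w * pack (shiftUp d f) (d + n) ∎
    where open ≡-Reasoning

  word-fits : ∀ X → Fits (word w X)
  word-fits X j = mod2^<2^ _ w

  word-pack : ∀ n f → Fits f → ∀ j → j < n → word w (pack f n) j ≡ f j
  word-pack (suc n) f fits zero _ = begin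
    mod2^ (div2^ (f 0 + 2 ^ w * p) 0) w ≡⟨ cong (λ z → mod2^ z w) (n/1≡n _) ⟩
    mod2^ (f 0 + 2 ^ w * p) w           ≡⟨ cong (λ z → mod2^ (f 0 + z) w) (*-comm (2 ^ w) p) ⟩
    mod2^ (f 0 + p * 2 ^ w) w           ≡⟨ mod2^-low w (f 0) p (fits 0) ⟩
    f 0                                 ∎
    where
    open ≡-Reasoning
    p = pack (f ∘ suc) n
  word-pack (suc n) f fits (suc j) (s≤s j<n) = begin
    mod2^ (div2^ P (w + j * w)) w          ≡⟨ cong (λ z → mod2^ z w) (div2^-+ P w (j * w)) ⟩
    mod2^ (div2^ (div2^ P w) (j * w)) w    ≡⟨ cong (λ z → mod2^ (div2^ z (j * w)) w) P/2^w≡p ⟩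
    word w p j                             ≡⟨ word-pack n (f ∘ suc) (fits ∘ suc) j j<n ⟩
    f (suc j)                              ∎
    where
    open ≡-Reasoning
    p = pack (f ∘ suc) n
    P = f 0 + 2 ^ w * p
    P/2^w≡p : div2^ P w ≡ p
    P/2^w≡p = trans (cong (λ z → div2^ (f 0 + z) w) (*-comm (2 ^ w) p)) (div2^-high w (f 0) p (fits 0))

  word-≥ : ∀ X n j → X < 2 ^ (n * w) → n ≤ j → word w X j ≡ 0
  word-≥ X n j X<2^nw n≤j = begin
    mod2^ (div2^ X (j * w)) w ≡⟨ cong (λ z → mod2^ z w) (div2^-small X (j * w) X<2^jw) ⟩
    mod2^ 0 w                 ≡⟨ mod2^-small 0 w (2^n>0 w) ⟩
    0                         ∎
    where
    open ≡-Reasoning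
    X<2^jw = <-≤-trans X<2^nw (2^-mono (*-monoˡ-≤ w n≤j))

  mod2^-pack-word : ∀ n X → mod2^ X (n * w) ≡ pack (word w X) n
  mod2^-pack-word zero    X = n%1≡0 X
  mod2^-pack-word (suc n) X = begin
    mod2^ X (w + n * w)                            ≡⟨ mod2^-+ X w (n * w) ⟩
    mod2^ X w + 2 ^ w * mod2^ (div2^ X w) (n * w)
      ≡⟨ cong₂ (λ a b → a + 2 ^ w * b) (cong (λ z → mod2^ z w) (sym (n/1≡n X))) (mod2^-pack-word n (div2^ X w)) ⟩
    word w X 0 + 2 ^ w * pack (word w (div2^ X w)) n
      ≡⟨ cong (λ z → word w X 0 + 2 ^ w * z)
              (pack-cong n _ _ (λ j _ → cong (λ z → mod2^ z w) (sym (div2^-+ X w (j * w))))) ⟩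
    word w X 0 + 2 ^ w * pack (word w X ∘ suc) n   ∎
    where open ≡-Reasoning

  pack-word : ∀ X → X < 2 ^ (w * w) → pack (word w X) w ≡ X
  pack-word X X<2^ww = trans (sym (mod2^-pack-word w X)) (mod2^-small X (w * w) X<2^ww)

  mod2^-pack : ∀ a b f → Fits f → mod2^ (pack f (a + b)) (a * w) ≡ pack f a
  mod2^-pack a b f fits = begin
    mod2^ (pack f (a + b)) (a * w)      ≡⟨ cong (λ z → mod2^ z (a * w)) (pack-++ a b f) ⟩
    mod2^ (pack f a + q * 2 ^ (a * w)) (a * w) ≡⟨ mod2^-low (a * w) (pack f a) q (pack<2^ a f fits) ⟩
    pack f a                            ∎
    where
    open ≡-Reasoning
    q = pack (λ j → f (a + j)) b

  div2^-pack : ∀ a b f → Fits f → div2^ (pack f (a + b)) (a * w) ≡ pack (λ j → f (a + j)) b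
  div2^-pack a b f fits = begin
    div2^ (pack f (a + b)) (a * w)      ≡⟨ cong (λ z → div2^ z (a * w)) (pack-++ a b f) ⟩
    div2^ (pack f a + q * 2 ^ (a * w)) (a * w) ≡⟨ div2^-high (a * w) (pack f a) q (pack<2^ a f fits) ⟩
    q                                   ∎
    where
    open ≡-Reasoning
    q = pack (λ j → f (a + j)) b

  shlMod-pack : ∀ d f → Fits f → shlMod (w * w) (pack f w) (d * w) ≡ pack (shiftUp d f) w
  shlMod-pack d f fits = begin
    mod2^ (pack f w * 2 ^ (d * w)) (w * w) ≡⟨ cong (λ z → mod2^ z (w * w)) (pack-shiftUp d w f) ⟩
    mod2^ (pack (shiftUp d f) (d + w)) (w * w)
      ≡⟨ cong (λ n → mod2^ (pack (shiftUp d f) n) (w * w)) (+-comm d w) ⟩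
    mod2^ (pack (shiftUp d f) (w + d)) (w * w) ≡⟨ mod2^-pack w d (shiftUp d f) (shiftUp-fits d f fits) ⟩
    pack (shiftUp d f) w                    ∎
    where open ≡-Reasoning

  truncate-pack : ∀ f ℓ → ℓ ≤ w → Fits f →
    div2^ (shlMod (w * w) (pack f w) ((w ∸ ℓ) * w)) ((w ∸ ℓ) * w) ≡ pack f ℓ
  truncate-pack f ℓ ℓ≤w fits = begin
    div2^ (shlMod (w * w) (pack f w) (s * w)) (s * w) ≡⟨ cong (λ z → div2^ z (s * w)) (shlMod-pack s f fits) ⟩
    div2^ (pack (shiftUp s f) w) (s * w)
      ≡⟨ cong (λ n → div2^ (pack (shiftUp s f) n) (s * w)) (sym (m∸n+n≡m ℓ≤w)) ⟩
    div2^ (pack (shiftUp s f) (s + ℓ)) (s * w)        ≡⟨ div2^-pack s ℓ (shiftUp s f) (shiftUp-fits s f fits) ⟩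
    pack (λ j → shiftUp s f (s + j)) ℓ               ≡⟨ pack-cong ℓ _ _ (λ j _ → shiftUp-+ s f j) ⟩
    pack f ℓ                                         ∎
    where
    open ≡-Reasoning
    s = w ∸ ℓ

  -- Modulo 2^(nw) only the low n words of a factor matter, so the step reuses the case n.
  pack-*-ones : ∀ n x → Fits x → Fits (psum x ∘ suc) →
    mod2^ (pack x n * pack ones n) (n * w) ≡ pack (psum x ∘ suc) n
  pack-*-ones zero    x _      _          = n%1≡0 0
  pack-*-ones (suc n) x x-fits psum-fits = begin
    mod2^ (P * (1 + B * O)) (w + n * w)
      ≡⟨ %-congʳ {{2^n≢0 (w + n * w)}} (^-distribˡ-+-* 2 w (n * w)) ⟩
    (P * (1 + B * O)) % (B * K)
      ≡⟨ cong (_% (B * K)) (solve 3 (λ P B O → P :* (con 1 :+ B :* O) := P :+ B :* (P :* O)) refl P B O) ⟩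
    (P + B * (P * O)) % (B * K)
      ≡⟨ [m+n*o]%[n*p]≡[m+n*[o%p]]%[n*p] P B (P * O) K ⟩
    (P + B * ((P * O) % K)) % (B * K)   ≡⟨ cong (λ z → (P + B * z) % (B * K)) P*O%K≡S ⟩
    (P + B * S) % (B * K)               ≡⟨ cong (_% (B * K)) P+B*S≡pack ⟩
    pack (psum x ∘ suc) (suc n) % (B * K)
      ≡⟨ %-congʳ {o = pack (psum x ∘ suc) (suc n)} {{_}} {{2^n≢0 (w + n * w)}} (sym (^-distribˡ-+-* 2 w (n * w))) ⟩
    mod2^ (pack (psum x ∘ suc) (suc n)) (suc n * w)
      ≡⟨ mod2^-small _ (suc n * w) (pack<2^ (suc n) _ psum-fits) ⟩
    pack (psum x ∘ suc) (suc n)         ∎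
    where
    open ≡-Reasoning
    P = pack x (suc n)
    O = pack ones n
    B = 2 ^ w
    K = 2 ^ (n * w)
    S = pack (psum x ∘ suc) n
    instance
      K≢0 : NonZero K
      K≢0 = 2^n≢0 (n * w)
      B*K≢0 : NonZero (B * K)
      B*K≢0 = m*n≢0 B K {{2^n≢0 w}} {{K≢0}}
    P%K≡ : mod2^ P (n * w) ≡ pack x n
    P%K≡ = trans (cong (λ m → mod2^ (pack x m) (n * w)) (+-comm 1 n)) (mod2^-pack n 1 x x-fits)
    P*O%K≡S : (P * O) % K ≡ S
    P*O%K≡S = begin
      (P * O) % K          ≡⟨ [m*n]%o≡[m%o*n]%o P O K ⟩
      ((P % K) * O) % K    ≡⟨ cong (λ z → (z * O) % K) P%K≡ ⟩
      (pack x n * O) % K   ≡⟨ pack-*-ones n x x-fits psum-fits ⟩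
      S                    ∎
    P+B*S≡pack : P + B * S ≡ pack (psum x ∘ suc) (suc n)
    P+B*S≡pack = begin
      P + B * S                                   ≡⟨ sym (pack-+ (suc n) x (shiftUp 1 (psum x ∘ suc))) ⟩
      pack (λ j → x j + shiftUp 1 (psum x ∘ suc) j) (suc n) ≡⟨ pack-cong (suc n) _ _ psum-step ⟩
      pack (psum x ∘ suc) (suc n)                 ∎
      where
      psum-step : ∀ j → j < suc n → x j + shiftUp 1 (psum x ∘ suc) j ≡ psum x (suc j)
      psum-step zero    _ = +-identityʳ (x 0)
      psum-step (suc j) _ = +-comm (x (suc j)) (psum x (suc j))

⌈log₂[2+n]⌉>0 : ∀ n → 0 < ⌈log₂ (2 + n) ⌉
⌈log₂[2+n]⌉>0 n = subst (_≤ ⌈log₂ (2 + n) ⌉) (⌈log₂2^n⌉≡n 1) (⌈log₂⌉-mono-≤ {2} {2 + n} (s≤s (s≤s z≤n)))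

⌈log₂[1+⌊[1+n]/2⌋]⌉≡⌈log₂[2+n]⌉∸1 : ∀ n → ⌈log₂ (suc ⌊ suc n /2⌋) ⌉ ≡ ⌈log₂ (2 + n) ⌉ ∸ 1
⌈log₂[1+⌊[1+n]/2⌋]⌉≡⌈log₂[2+n]⌉∸1 n = ⌈log₂⌈n/2⌉⌉≡⌈log₂n⌉∸1 (2 + n)

run-+ : ∀ w p a b s → run w p (a + b) s ≡ run w p b (run w p a s)
run-+ w p zero    b s = refl
run-+ w p (suc a) b s = run-+ w p a b (step w p s)

HaltsWithPrefixSum : (w ℓ X : ℕ) → Program → State → Set
HaltsWithPrefixSum w ℓ X p s = Halted p s × IsPrefixSum w ℓ X (U s 0)

-- Clears the words of U0 from position ℓ on by shifting up by w − ℓ words and back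
-- down, given W0 = w, W1 = ℓ and W9 = w − 1.  Each shift by (w − ℓ)·w bits is split
-- into shifts by w − ℓ and (w − ℓ)(w − 1), so that both amounts are below 2^w.
truncation : Program
truncation =
  wop sub 7 0 1 ∷ wop mul 8 7 9 ∷ ushl 0 0 7 ∷ ushl 0 0 8 ∷ ushr 0 0 7 ∷ ushr 0 0 8 ∷ halt ∷ []

multiplicationProgram : ℕ → Program
multiplicationProgram w =
  uconst 1 (Packing.pack w ones w) ∷ uop mul 0 0 1 ∷ wconst 5 1 ∷ wop sub 9 0 5 ∷ truncation

-- In round k, with d = 2^k: W2 = d and W4 = d(w − 1) (together a shift by d words),
-- and the loop stops when W3 = ⌊(ℓ − 1)/d⌋ is 0, i.e. once d ≥ ℓ.  W6 = 0 makes the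
-- last jump unconditional.
doublingProgram : Program
doublingProgram =
  jz 1 20 ∷ wconst 2 1 ∷ wconst 5 1 ∷ wop sub 3 1 5 ∷ wop sub 9 0 5 ∷ wop sub 4 0 5 ∷
  jz 3 14 ∷ ushl 1 0 2 ∷ ushl 1 1 4 ∷ uop add 0 0 1 ∷ wop add 2 2 2 ∷ wop add 4 4 4 ∷
  wop shr 3 3 5 ∷ jz 6 6 ∷
  truncation

truncation-allowed : ∀ M → All (Allowed M) truncation
truncation-allowed restricted     = tt ∷ tt ∷ tt ∷ tt ∷ tt ∷ tt ∷ tt ∷ []
truncation-allowed multiplication = tt ∷ tt ∷ tt ∷ tt ∷ tt ∷ tt ∷ tt ∷ []

multiplicationProgram-allowed : ∀ w → All (Allowed multiplication) (multiplicationProgram w)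
multiplicationProgram-allowed w = ++⁺ (tt ∷ tt ∷ tt ∷ tt ∷ []) (truncation-allowed multiplication)

doublingProgram-allowed : All (Allowed restricted) doublingProgram
doublingProgram-allowed =
  ++⁺ (tt ∷ tt ∷ tt ∷ tt ∷ tt ∷ tt ∷ tt ∷ tt ∷ tt ∷ tt ∷ tt ∷ tt ∷ tt ∷ tt ∷ []) (truncation-allowed restricted)

module _ (w : ℕ) where

  test-exits : ∀ t Wr Ur → Wr 3 ≡ 0 →
    run w doublingProgram (suc t) (st 6 Wr Ur) ≡ run w doublingProgram t (st 14 Wr Ur)
  test-exits t Wr Ur W3≡0 = cong (λ z → run w doublingProgram t (st (if z ≡ᵇ 0 then 14 else 7) Wr Ur)) W3≡0

  test-continues : ∀ t Wr Ur r → Wr 3 ≡ suc r →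
    run w doublingProgram (suc t) (st 6 Wr Ur) ≡ run w doublingProgram t (st 7 Wr Ur)
  test-continues t Wr Ur r W3≡1+r = cong (λ z → run w doublingProgram t (st (if z ≡ᵇ 0 then 14 else 7) Wr Ur)) W3≡1+r

  round-returns-to-test : ∀ t Wr Ur r → Wr 3 ≡ suc r → Wr 6 ≡ 0 → let s = run w doublingProgram 7 (st 7 Wr Ur) in
    run w doublingProgram (suc 7 + t) (st 6 Wr Ur) ≡ run w doublingProgram t (st 6 (W s) (U s))
  round-returns-to-test t Wr Ur r W3≡1+r W6≡0 = begin
    run w doublingProgram (suc 7 + t) (st 6 Wr Ur)
      ≡⟨ run-+ w doublingProgram (suc 7) t (st 6 Wr Ur) ⟩
    run w doublingProgram t (run w doublingProgram (suc 7) (st 6 Wr Ur))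
      ≡⟨ cong (run w doublingProgram t) (test-continues 7 Wr Ur r W3≡1+r) ⟩
    run w doublingProgram t s
      ≡⟨ cong (run w doublingProgram t) back-to-test ⟩
    run w doublingProgram t (st 6 (W s) (U s)) ∎
    where
    open ≡-Reasoning
    s = run w doublingProgram 7 (st 7 Wr Ur)
    back-to-test : s ≡ st 6 (W s) (U s)
    back-to-test = cong (λ z → st (if z ≡ᵇ 0 then 6 else 14) (W s) (U s)) W6≡0

  one-more-round : ∀ {ℓ X n} Wr Ur r → Wr 3 ≡ suc r → Wr 6 ≡ 0 →
    let s = run w doublingProgram 7 (st 7 Wr Ur) ; Done = HaltsWithPrefixSum w ℓ X doublingProgram in
    Σ ℕ (λ t → t ≤ 8 * n + 7 × Done (run w doublingProgram t (st 6 (W s) (U s)))) →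
    Σ ℕ (λ t → t ≤ 8 * suc n + 7 × Done (run w doublingProgram t (st 6 Wr Ur)))
  one-more-round {ℓ} {X} {n} Wr Ur r W3≡1+r W6≡0 (t , t≤ , done) =
    suc 7 + t ,
    subst (suc 7 + t ≤_) (solve 1 (λ n → con 8 :+ (con 8 :* n :+ con 7) := con 8 :* (con 1 :+ n) :+ con 7) refl n)
          (+-monoʳ-≤ 8 t≤) ,
    subst (HaltsWithPrefixSum w ℓ X doublingProgram) (sym (round-returns-to-test t Wr Ur r W3≡1+r W6≡0)) done

module Input (v ℓ X : ℕ) (hasLength : HasLength (suc v) ℓ X) (sumsFit : SumsFit (suc v) ℓ X) where

  w : ℕ
  w = suc v

  open Packing w

  x : ℕ → ℕ
  x = word w X

  X<2^ww : X < 2 ^ (w * w)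
  X<2^ww = proj₁ hasLength

  ℓ≤w : ℓ ≤ w
  ℓ≤w = proj₁ (proj₂ hasLength)

  x-vanishes : ∀ k → ℓ ≤ k → x k ≡ 0
  x-vanishes k ℓ≤k with k <? w
  ... | yes k<w = proj₂ (proj₂ hasLength) k ℓ≤k k<w
  ... | no  k≮w = word-≥ X w k X<2^ww (≮⇒≥ k≮w)

  prefix-fits : ∀ j → j < ℓ → psum x (suc j) < 2 ^ w
  prefix-fits j j<ℓ =
    <-≤-trans (subst (_< 2 ^ (w ∸ 1)) (prefix≡psum w X j) (sumsFit j j<ℓ)) (2^-mono (m∸n≤m w 1))

  psum-ℓ-fits : ∀ m → m ≡ ℓ → psum x m < 2 ^ w
  psum-ℓ-fits zero    _    = 2^n>0 w
  psum-ℓ-fits (suc m) refl = prefix-fits m ≤-refl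

  psum-fits : Fits (psum x ∘ suc)
  psum-fits j with j <? ℓ
  ... | yes j<ℓ = prefix-fits j j<ℓ
  ... | no  j≮ℓ = subst (_< 2 ^ w) (sym (psum-stable x ℓ x-vanishes (suc j) ℓ≤1+j)) (psum-ℓ-fits ℓ refl)
    where ℓ≤1+j = m≤n⇒m≤1+n (≮⇒≥ j≮ℓ)

  window-fits : ∀ d → Fits (window d x)
  window-fits d j = ≤-<-trans (window≤psum d x j) (psum-fits j)

  pack-isPrefixSum : ∀ g → Fits g → (∀ j → j < ℓ → g j ≡ psum x (suc j)) → IsPrefixSum w ℓ X (pack g ℓ)
  pack-isPrefixSum g fits g≡psum =
    (<-≤-trans P<2^ℓw (2^-mono (*-monoˡ-≤ w ℓ≤w)) , ℓ≤w , λ j ℓ≤j _ → word-≥ (pack g ℓ) ℓ j P<2^ℓw ℓ≤j) ,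
    λ j j<ℓ → trans (word-pack ℓ g fits j j<ℓ) (trans (g≡psum j j<ℓ) (sym (prefix≡psum w X j)))
    where P<2^ℓw = pack<2^ ℓ g fits

  mod2^-1 : mod2^ 1 w ≡ 1
  mod2^-1 = mod2^-small 1 w (2^-mono {1} {w} (s≤s z≤n))

  w∸1≡v : subMod w w (mod2^ 1 w) ≡ v
  w∸1≡v = trans (cong (subMod w w) mod2^-1) (subMod≡∸ w w 1 (s≤s z≤n) (n<2^n w))

  truncation-correct : ∀ g P W0 W1 W9 → Fits g → P ≡ pack g w → W0 ≡ w → W1 ≡ ℓ → W9 ≡ v →
    let s = subMod w W0 W1 ; t = mulMod w s W9 in
    shrB (w * w) (shrB (w * w) (shlMod (w * w) (shlMod (w * w) P s) t) s) t ≡ pack g ℓ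
  truncation-correct g .(pack g w) .w .ℓ .v fits refl refl refl refl = begin
    shrB ww (shrB ww (shlMod ww (shlMod ww P S) T) S) T
      ≡⟨ cong₂ (λ s t → shrB ww (shrB ww (shlMod ww (shlMod ww P s) t) s) t) S≡s T≡s*v ⟩
    shrB ww (shrB ww (shlMod ww (shlMod ww P s) (s * v)) s) (s * v)
      ≡⟨ cong (λ z → shrB ww (shrB ww z s) (s * v)) (shlMod-+ ww P s (s * v)) ⟩
    shrB ww (shrB ww (shlMod ww P (s + s * v)) s) (s * v)
      ≡⟨ shrB-+ ww _ s (s * v) (mod2^<2^ _ ww) ⟩
    div2^ (shlMod ww P (s + s * v)) (s + s * v)
      ≡⟨ cong (λ n → div2^ (shlMod ww P n) n) (sym (*-suc s v)) ⟩
    div2^ (shlMod ww P (s * w)) (s * w)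
      ≡⟨ truncate-pack g ℓ ℓ≤w fits ⟩
    pack g ℓ ∎
    where
    open ≡-Reasoning
    ww = w * w
    P = pack g w
    s = w ∸ ℓ
    S = subMod w w ℓ
    T = mulMod w S v
    S≡s : S ≡ s
    S≡s = subMod≡∸ w w ℓ ℓ≤w (n<2^n w)
    T≡s*v : T ≡ s * v
    T≡s*v = trans (cong (λ z → mulMod w z v) S≡s)
                  (mod2^-small (s * v) w (≤-<-trans (*-monoˡ-≤ v (m∸n≤m w ℓ)) ([1+n]*n<2^[1+n] v)))

  ones-fits : Fits ones
  ones-fits _ = 2^-mono {1} {w} (s≤s z≤n)

  X*ones≡prefixSums : mulMod (w * w) X (mod2^ (pack ones w) (w * w)) ≡ pack (psum x ∘ suc) w
  X*ones≡prefixSums = begin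
    mulMod (w * w) X (mod2^ (pack ones w) (w * w))
      ≡⟨ cong₂ (mulMod (w * w)) (sym (pack-word X X<2^ww)) (mod2^-small _ (w * w) (pack<2^ w ones ones-fits)) ⟩
    mod2^ (pack x w * pack ones w) (w * w) ≡⟨ pack-*-ones w x (word-fits X) psum-fits ⟩
    pack (psum x ∘ suc) w                  ∎
    where open ≡-Reasoning

  multiplicationProgram-halts : let p = multiplicationProgram w in
    HaltsWithPrefixSum w ℓ X p (run w p 10 (initState w ℓ X))
  multiplicationProgram-halts =
    refl , subst (IsPrefixSum w ℓ X) (sym U0≡prefixSums) (pack-isPrefixSum (psum x ∘ suc) psum-fits (λ _ _ → refl))
    where
    U0≡prefixSums : U (run w (multiplicationProgram w) 10 (initState w ℓ X)) 0 ≡ pack (psum x ∘ suc) ℓ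
    U0≡prefixSums = truncation-correct (psum x ∘ suc) _ _ _ _ psum-fits X*ones≡prefixSums refl refl w∸1≡v

  Done : State → Set
  Done = HaltsWithPrefixSum w ℓ X doublingProgram

  record Invariant (k : ℕ) (Wr Ur : ℕ → ℕ) : Set where
    field
      W0≡w       : Wr 0 ≡ w
      W1≡ℓ       : Wr 1 ≡ ℓ
      W2≡d       : Wr 2 ≡ mod2^ (2 ^ k) w
      W3≡count   : Wr 3 ≡ div2^ (ℓ ∸ 1) k
      W4≡d*v     : Wr 4 ≡ mod2^ (2 ^ k * v) w
      W5≡1       : Wr 5 ≡ 1
      W6≡0       : Wr 6 ≡ 0
      W9≡v       : Wr 9 ≡ v
      U0≡windows : Ur 0 ≡ pack (window (2 ^ k) x) w

  invariant-init : ∀ l → ℓ ≡ suc l →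
    let s = run w doublingProgram 6 (initState w ℓ X) in Invariant 0 (W s) (U s)
  invariant-init l refl = record
    { W0≡w       = refl
    ; W1≡ℓ       = refl
    ; W2≡d       = refl
    ; W3≡count   = trans (cong (subMod w (suc l)) mod2^-1)
                         (trans (subMod≡∸ w (suc l) 1 (s≤s z≤n) (≤-<-trans ℓ≤w (n<2^n w))) (sym (n/1≡n l)))
    ; W4≡d*v     = trans w∸1≡v (sym (trans (cong (λ z → mod2^ z w) (*-identityˡ v))
                                           (mod2^-small v w (≤-<-trans (n≤1+n v) (n<2^n w)))))
    ; W5≡1       = mod2^-1
    ; W6≡0       = refl
    ; W9≡v       = w∸1≡v
    ; U0≡windows = trans (sym (pack-word X X<2^ww)) (pack-cong w _ _ (λ j _ → sym (window-1 x j)))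
    }

  windows-double : ∀ d → let P = pack (window d x) w in
    addMod (w * w) P (shlMod (w * w) (shlMod (w * w) P d) (d * v)) ≡ pack (window (2 * d) x) w
  windows-double d = begin
    addMod ww P (shlMod ww (shlMod ww P d) (d * v))
      ≡⟨ cong (addMod ww P) (trans (shlMod-+ ww P d (d * v)) (cong (shlMod ww P) (sym (*-suc d v)))) ⟩
    addMod ww P (shlMod ww P (d * w))             ≡⟨ cong (addMod ww P) (shlMod-pack d g (window-fits d)) ⟩
    mod2^ (P + pack (shiftUp d g) w) ww           ≡⟨ cong (λ z → mod2^ z ww) (sym (pack-+ w g (shiftUp d g))) ⟩
    mod2^ (pack (λ j → g j + shiftUp d g j) w) ww ≡⟨ cong (λ z → mod2^ z ww) (pack-cong w _ _ doubled) ⟩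
    mod2^ (pack (window (2 * d) x) w) ww          ≡⟨ mod2^-small _ ww (pack<2^ w _ (window-fits (2 * d))) ⟩
    pack (window (2 * d) x) w                     ∎
    where
    open ≡-Reasoning
    ww = w * w
    g = window d x
    P = pack g w
    doubled : ∀ j → j < w → g j + shiftUp d g j ≡ window (2 * d) x j
    doubled j _ = trans (window-double d x j) (cong (λ e → window e x j) (m+m≡2*m d))

  invariant-step : ∀ k Wr Ur → Invariant k Wr Ur → ∀ r → div2^ (ℓ ∸ 1) k ≡ suc r →
    let s = run w doublingProgram 7 (st 7 Wr Ur) in Invariant (suc k) (W s) (U s)
  invariant-step k Wr Ur inv r count≡1+r = record
    { W0≡w       = W0≡w
    ; W1≡ℓ       = W1≡ℓ
    ; W2≡d       = trans (cong₂ (addMod w) W2≡d W2≡d) (addMod-double w d)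
    ; W3≡count   = trans (cong₂ (shrB w) W3≡count W5≡1)
                         (trans (shrB-1 w _ count<2^w) (sym (div2^-suc (ℓ ∸ 1) k)))
    ; W4≡d*v     = trans (cong₂ (addMod w) W4≡d*v W4≡d*v)
                         (trans (addMod-double w (d * v)) (cong (λ z → mod2^ z w) (sym (*-assoc 2 d v))))
    ; W5≡1       = W5≡1
    ; W6≡0       = W6≡0
    ; W9≡v       = W9≡v
    ; U0≡windows = trans (cong₂ (λ P a → addMod (w * w) P (shlMod (w * w) (shlMod (w * w) P (proj₁ a)) (proj₂ a)))
                                U0≡windows (cong₂ _,_ (trans W2≡d d-in-range) (trans W4≡d*v d*v-in-range)))
                         (windows-double d)
    }
    where
    open Invariant inv
    d = 2 ^ k
    d≤v : d ≤ v
    d≤v = ≤-trans (m/n≢0⇒n≤m {{2^n≢0 k}} (λ count≡0 → 0≢1+n (trans (sym count≡0) count≡1+r)))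
                  (∸-monoˡ-≤ 1 ℓ≤w)
    d-in-range : mod2^ d w ≡ d
    d-in-range = mod2^-small d w (≤-<-trans (≤-trans d≤v (n≤1+n v)) (n<2^n w))
    d*v-in-range : mod2^ (d * v) w ≡ d * v
    d*v-in-range = mod2^-small (d * v) w (≤-<-trans (*-monoˡ-≤ v (≤-trans d≤v (n≤1+n v))) ([1+n]*n<2^[1+n] v))
    count<2^w : div2^ (ℓ ∸ 1) k < 2 ^ w
    count<2^w = ≤-<-trans (m/n≤m (ℓ ∸ 1) d {{2^n≢0 k}}) (≤-<-trans (∸-monoˡ-≤ 1 ℓ≤w) (≤-<-trans (n≤1+n v) (n<2^n w)))

  loop-exit : ∀ k Wr Ur → Invariant k Wr Ur → div2^ (ℓ ∸ 1) k ≡ 0 → Done (run w doublingProgram 6 (st 14 Wr Ur))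
  loop-exit k Wr Ur inv count≡0 =
    refl , subst (IsPrefixSum w ℓ X) (sym U0≡prefixSums) (pack-isPrefixSum g (window-fits d) g≡psum)
    where
    open Invariant inv
    d = 2 ^ k
    g = window d x
    ℓ≤d : ℓ ≤ d
    ℓ≤d = m∸1<n⇒m≤n (m/n≡0⇒m<n {{2^n≢0 k}} count≡0)
    g≡psum : ∀ j → j < ℓ → g j ≡ psum x (suc j)
    g≡psum j j<ℓ = window-≥ d x j (≤-trans j<ℓ ℓ≤d)
    U0≡prefixSums : U (run w doublingProgram 6 (st 14 Wr Ur)) 0 ≡ pack g ℓ
    U0≡prefixSums = truncation-correct g (Ur 0) (Wr 0) (Wr 1) (Wr 9) (window-fits d) U0≡windows W0≡w W1≡ℓ W9≡v

  -- The measure ⌈log₂ (1 + count)⌉ drops by one per round since the count is halved.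
  loop : ∀ n k Wr Ur → Invariant k Wr Ur → ∀ q → div2^ (ℓ ∸ 1) k ≡ q → ⌈log₂ (suc q) ⌉ ≡ n →
    Σ ℕ λ t → t ≤ 8 * n + 7 × Done (run w doublingProgram t (st 6 Wr Ur))
  loop n k Wr Ur inv zero count≡0 _ =
    suc 6 , m≤n+m 7 (8 * n) ,
    subst Done (sym (test-exits w 6 Wr Ur (trans (Invariant.W3≡count inv) count≡0))) (loop-exit k Wr Ur inv count≡0)
  loop zero k Wr Ur inv (suc r) _ log≡0 = ⊥-elim (<⇒≢ (⌈log₂[2+n]⌉>0 r) (sym log≡0))
  loop (suc n) k Wr Ur inv (suc r) count≡1+r log≡1+n =
    one-more-round w Wr Ur r (trans (Invariant.W3≡count inv) count≡1+r) (Invariant.W6≡0 inv)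
      (loop n (suc k) (W s) (U s) (invariant-step k Wr Ur inv r count≡1+r)
            ⌊ suc r /2⌋ (trans (div2^-suc (ℓ ∸ 1) k) (cong ⌊_/2⌋ count≡1+r))
            (trans (⌈log₂[1+⌊[1+n]/2⌋]⌉≡⌈log₂[2+n]⌉∸1 r) (cong (_∸ 1) log≡1+n)))
    where s = run w doublingProgram 7 (st 7 Wr Ur)

  doublingProgram-halts : ∀ l → ℓ ≡ suc l →
    Σ ℕ λ t → t ≤ 13 * suc ⌈log₂ ℓ ⌉ × Done (run w doublingProgram t (initState w ℓ X))
  doublingProgram-halts l refl =
    6 + t , 6+t≤ , subst Done (sym (run-+ w doublingProgram 6 t (initState w ℓ X))) (proj₂ (proj₂ rest))
    where
    n = ⌈log₂ ℓ ⌉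
    s = run w doublingProgram 6 (initState w ℓ X)
    rest = loop n 0 (W s) (U s) (invariant-init l refl) l (n/1≡n l) refl
    t = proj₁ rest
    6+t≤ : 6 + t ≤ 13 * suc n
    6+t≤ = begin
      6 + t           ≤⟨ +-monoʳ-≤ 6 (proj₁ (proj₂ rest)) ⟩
      6 + (8 * n + 7) ≡⟨ solve 1 (λ n → con 6 :+ (con 8 :* n :+ con 7) := con 13 :+ con 8 :* n) refl n ⟩
      13 + 8 * n      ≤⟨ +-monoʳ-≤ 13 (*-monoˡ-≤ n (m≤m+n 8 5)) ⟩
      13 + 13 * n     ≡⟨ sym (*-suc 13 n) ⟩
      13 * suc n      ∎
      where open ≤-Reasoning

doubling-correct : ∀ w → ComputesPrefixSumIn w doublingProgram (λ ℓ → 13 * suc ⌈log₂ ℓ ⌉)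
doubling-correct w       zero    X hasLength _       = 1 , s≤s z≤n , refl , hasLength , λ _ ()
doubling-correct zero    (suc l) X (_ , () , _) _
doubling-correct (suc v) (suc l) X hasLength sumsFit = Input.doublingProgram-halts v (suc l) X hasLength sumsFit l refl

multiplication-correct : ∀ w → ComputesPrefixSumIn w (multiplicationProgram w) (λ _ → 10)
-- For w = 0 the only input is X = 0 with ℓ = 0, on which the program computes 0.
multiplication-correct zero ℓ X (s≤s z≤n , z≤n , _) _ = 10 , ≤-refl , refl , (s≤s z≤n , z≤n , λ _ _ ()) , λ _ ()
multiplication-correct (suc v) ℓ X hasLength sumsFit =
  10 , ≤-refl , Input.multiplicationProgram-halts v ℓ X hasLength sumsFit

lemma1 : PrefixSumIn restricted (λ ℓ → suc ⌈log₂ ℓ ⌉) × PrefixSumIn multiplication (λ ℓ → 1)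
lemma1 =
  (13 , λ w → doublingProgram , doublingProgram-allowed , doubling-correct w) ,
  (10 , λ w → multiplicationProgram w , multiplicationProgram-allowed w , multiplication-correct w)
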